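{- Let $k,m,n\geq 2$ and let $\Sigma$ be an alphabet with $|\Sigma|=k$. The $(m,n)_k$-ring graph is Eulerian: every vertex has in-degree equal to its out-degree, and (the graph being weakly connected) there is a closed directed walk traversing every edge exactly once.
   Context: $\Sigma$ is a finite totally ordered alphabet; $\Sigma^{m,n}$ denotes the set of $m\times n$ arrays (patterns) over $\Sigma$, and for arrays $X,Y$ with the same number of rows $[X,Y]$ denotes horizontal concatenation. For a pattern $P$ with rows $r_1,\dots,r_m\in\Sigma^{n}$, view $P$ as the word $[r_1,\dots,r_m]$ over the alphabet $\Sigma^n$ (ordered lexicographically). $P$ is row-Lyndon if this word is a Lyndon word (strictly smaller lexicographically than all its nontrivial cyclic rotations). $lexmin(P)$ denotes the cyclic rotation of the rows of $P$ whose corresponding word is lexicographically smallest. The $(m,n)_k$-ring graph is the labeled multidigraph whose vertex set is $\{lexmin(S)\mid S\in\Sigma^{m,n-1}\}$ and which, for vertices $P_1,P_2$, has one edge from $P_1$ to $P_2$ with label $R$ for each $R\in\Sigma^{m,1}$ such that there exist $L\in\Sigma^{m,1}$, $C\in\Sigma^{m,n-2}$ with: (1) $P_1=[L,C]$ and $P_2=lexmin([C,R])$; (2) $lexmin([L,C,R])$ is a row-Lyndon pattern of shape $(m,n)$; (3) there is no $R'\in\Sigma^{m,1}$ with $R'<R$ and $lexmin([L,C,R'])=lexmin([L,C,R])$. (Distinct applicable labels give distinct parallel edges.) -}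

module Defs where

open import Data.Nat using (ℕ; zero; suc; _<_; _≤_)
open import Data.Fin as Fin using (Fin)
open import Data.Vec using (Vec; []; _∷_; _∷ʳ_; zipWith; map)
open import Data.Vec.Relation.Binary.Lex.Strict using (Lex-<)
open import Data.List using (List; []; _∷_; length)
open import Data.List.Membership.Propositional using (_∈_)
open import Data.List.Relation.Unary.Unique.Propositional using (Unique)
open import Data.Product using (Σ; ∃; ∃-syntax; _×_; _,_; proj₁; proj₂)
open import Data.Sum using (_⊎_)
open import Relation.Nullary using (¬_)
open import Relation.Binary.PropositionalEquality using (_≡_)
open import Function.Bundles using (_⇔_)

LexLt : {A : Set} → (A → A → Set) → {n : ℕ} → Vec A n → Vec A n → Set
LexLt _≺_ u v = Lex-< _≡_ _≺_ u v

Row : ℕ → ℕ → Set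
Row k w = Vec (Fin k) w

_<ᵣ_ : {k w : ℕ} → Row k w → Row k w → Set
_<ᵣ_ {k} = LexLt (Fin._<_ {k})

Pattern : ℕ → ℕ → ℕ → Set
Pattern k m w = Vec (Row k w) m

_<ₚ_ : {k m w : ℕ} → Pattern k m w → Pattern k m w → Set
_<ₚ_ {k} {m} {w} = LexLt (_<ᵣ_ {k} {w})

_≤ₚ_ : {k m w : ℕ} → Pattern k m w → Pattern k m w → Set
P ≤ₚ Q = P ≡ Q ⊎ P <ₚ Q

rotate1 : {A : Set} {m : ℕ} → Vec A m → Vec A m
rotate1 []       = []
rotate1 (x ∷ xs) = xs ∷ʳ x

rot : {A : Set} {m : ℕ} → ℕ → Vec A m → Vec A m
rot zero    xs = xs
rot (suc i) xs = rot i (rotate1 xs)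

RowLyndon : {k m w : ℕ} → Pattern k m w → Set
RowLyndon {m = m} P = (i : ℕ) → 1 ≤ i → i < m → P <ₚ rot i P

IsLexmin : {k m w : ℕ} → Pattern k m w → Pattern k m w → Set
IsLexmin {m = m} S Q =
  (∃[ i ] (i < m × rot i S ≡ Q)) × ((i : ℕ) → i < m → Q ≤ₚ rot i S)

Column : ℕ → ℕ → Set
Column k m = Vec (Fin k) m

colPat : {k m : ℕ} → Column k m → Pattern k m 1
colPat = map (λ a → a ∷ [])

_<c_ : {k m : ℕ} → Column k m → Column k m → Set
R′ <c R = colPat R′ <ₚ colPat R

[_,_]ˡ : {k m w : ℕ} → Column k m → Pattern k m w → Pattern k m (suc w)
[ L , C ]ˡ = zipWith _∷_ L C

[_,_]ʳ : {k m w : ℕ} → Pattern k m w → Column k m → Pattern k m (suc w)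
[ C , R ]ʳ = zipWith _∷ʳ_ C R

-- The (m,n)_k-ring graph, with c = n - 2 (so vertices are m × (n-1)
-- patterns, i.e. of width suc c, and edges come from m × n patterns
-- [L,C,R] of width suc (suc c)).

module RingGraph (k m c : ℕ) where

  VPat : Set
  VPat = Pattern k m (suc c)

  IsVertex : VPat → Set
  IsVertex P = ∃[ S ] IsLexmin S P

  Edge : Set
  Edge = VPat × Column k m × VPat

  src : Edge → VPat
  src (P₁ , R , P₂) = P₁

  tgt : Edge → VPat
  tgt (P₁ , R , P₂) = P₂

  -- Conditions (1)-(3) of the definition.  (An edge is determined by
  -- its source and label; distinct labels give distinct edges.)
  IsEdge : Edge → Set
  IsEdge (P₁ , R , P₂) =
    IsVertex P₁ × IsVertex P₂ ×
    ∃[ L ] ∃[ C ]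
      ( P₁ ≡ [ L , C ]ˡ
      × IsLexmin [ C , R ]ʳ P₂
      × (∃[ Q ] (IsLexmin [ L , [ C , R ]ʳ ]ˡ Q × RowLyndon Q))
      × ¬ (∃[ R′ ] (R′ <c R × ∃[ Q ] (IsLexmin [ L , [ C , R′ ]ʳ ]ˡ Q
                                   × IsLexmin [ L , [ C , R ]ʳ ]ˡ Q))))

  Enumerates : (Edge → Set) → List Edge → Set
  Enumerates Pr xs = Unique xs × ((e : Edge) → Pr e ⇔ (e ∈ xs))

  OutEdge InEdge : VPat → Edge → Set
  OutEdge v e = IsEdge e × src e ≡ v
  InEdge  v e = IsEdge e × tgt e ≡ v

  Balanced : VPat → Set
  Balanced v = ∃[ outs ] ∃[ ins ]
    (Enumerates (OutEdge v) outs × Enumerates (InEdge v) ins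
     × length outs ≡ length ins)

  WalkFrom : VPat → List Edge → VPat → Set
  WalkFrom u []       v = u ≡ v
  WalkFrom u (e ∷ es) v = src e ≡ u × WalkFrom (tgt e) es v

  EulerCircuit : List Edge → Set
  EulerCircuit es = Enumerates IsEdge es × ∃[ u ] WalkFrom u es u

  Eulerian : Set
  Eulerian = ((v : VPat) → IsVertex v → Balanced v) × ∃[ es ] EulerCircuit es

{-# OPTIONS --safe #-}

-- Each edge of the ring graph is determined by the row-Lyndon m × n pattern W it creates:
-- its source is the lexmin of W without the last column and its label is the least column
-- that rebuilds W.  Moving the last column of W to the front preserves primitivity, so it
-- yields another row-Lyndon pattern; on edges this is a bijection that turns every edge
-- leaving a vertex v into an edge entering v, hence in-degree = out-degree everywhere.
-- Appending the primitive column (1,0,…,0) to any pattern also gives a primitive, hence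
-- row-Lyndon, window; repeating it n - 1 times leads from every vertex to the vertex whose
-- rows are constant.  A balanced digraph in which every edge reaches one fixed vertex has
-- an Euler circuit, built by splicing closed trails (Hierholzer).

module Submission where

open import Defs

open import Data.Bool using (true; false)
open import Data.Empty using (⊥-elim)
import Data.Fin as Fin
import Data.Fin.Properties as Finₚ
open import Data.List as List
  using (List; []; _∷_; _++_; [_]; map; length; applyUpTo; filter; deduplicate; cartesianProductWith)
import Data.List.Extrema
import Data.List.Properties as Listₚ
open import Data.List.Membership.Propositional using (_∈_; _∉_)
open import Data.List.Membership.Propositional.Properties
  using (∈-map⁺; ∈-map⁻; ∈-++⁺ʳ; ∈-++⁻; ∈-∃++; ∈-filter⁺; ∈-filter⁻; ∈-applyUpTo⁺;
         ∈-applyUpTo⁻; ∈-allFin; ∈-cartesianProductWith⁺; ∈-deduplicate⁺; ∈-deduplicate⁻)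
open import Data.List.Membership.Propositional.Properties.WithK using (unique∧set⇒bag)
open import Data.List.Relation.Binary.BagAndSetEquality using (∼bag⇒↭)
open import Data.List.Relation.Binary.Permutation.Propositional
  using (_↭_; ↭-refl; ↭-sym; ↭-trans; ↭-prep; ↭-swap; ↭-reflexive; ↭⇒↭ₛ;
         module PermutationReasoning)
open import Data.List.Relation.Binary.Permutation.Propositional.Properties
  using (∈-resp-↭; ↭-length; shift; shifts; drop-∷; map⁺; ++⁺ˡ; ++⁺ʳ; ++-comm; filter-↭)
import Data.List.Relation.Binary.Permutation.Setoid.Properties as ↭ₛ
open import Data.List.Relation.Binary.Subset.Propositional using (_⊆_)
open import Data.List.Relation.Unary.All as All using (All; []; _∷_)
import Data.List.Relation.Unary.All.Properties as Allₚ
open import Data.List.Relation.Unary.AllPairs using ([]; _∷_)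
open import Data.List.Relation.Unary.Any using (here; there)
open import Data.List.Relation.Unary.Unique.Propositional using (Unique)
open import Data.List.Relation.Unary.Unique.Propositional.Properties using (filter⁺)
open import Data.List.Relation.Unary.Unique.DecPropositional.Properties using (deduplicate-!)
open import Data.Nat as ℕ using (ℕ; zero; suc; _+_; _*_; _∸_; _<_; _≤_; s≤s; z≤n)
import Data.Nat.Properties as ℕₚ
open import Data.Nat.DivMod using (_%_; _/_; m≡m%n+[m/n]*n; m%n<n)
open import Data.Nat.GeneralisedArithmetic using (iterate)
open import Data.Nat.Induction using (<-wellFounded)
open import Data.Product using (∃; ∃₂; ∃-syntax; _×_; _,_; proj₁; proj₂)
import Data.Product.Properties as ×ₚ
open import Data.Sum as Sum using (_⊎_; inj₁; inj₂)
open import Data.Vec as Vec using (Vec; []; _∷_; _∷ʳ_; zipWith; toList; head; tail; init; last; replicate)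
import Data.Vec.Properties as Vecₚ
import Data.Vec.Relation.Binary.Lex.Strict as Lex
open import Data.Vec.Relation.Binary.Pointwise.Inductive using (Pointwise-≡⇒≡; ≡⇒Pointwise-≡)
open import Function using (_∘_; _on_; mk⇔; Equivalence)
open import Induction.WellFounded using (Acc; acc)
open import Level using (0ℓ)
open import Relation.Binary.Bundles using (StrictTotalOrder; DecTotalOrder)
open import Relation.Binary.Core using (Rel)
open import Relation.Binary.Definitions using (DecidableEquality; Trichotomous; tri<; tri≈; tri>)
open import Relation.Binary.Properties.StrictTotalOrder using (decTotalOrder)
open import Relation.Binary.PropositionalEquality as ≡
  using (_≡_; refl; sym; trans; cong; cong₂; subst; subst₂; module ≡-Reasoning)
open import Relation.Binary.Structures using (IsStrictTotalOrder)
open import Relation.Nullary using (¬_; Dec; yes; no; does; _→-dec_)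
import Relation.Nullary.Decidable as Dec
open import Relation.Unary using (Pred; Decidable)
private variable
  A B C : Set
  n w : ℕ

-- Strict total orders and minima

module _ {_≺_ : Rel A 0ℓ} (≺-isSTO : IsStrictTotalOrder _≡_ _≺_) where
  private module ≺ = IsStrictTotalOrder ≺-isSTO

  LexLt-isStrictTotalOrder : IsStrictTotalOrder _≡_ (LexLt _≺_ {n})
  LexLt-isStrictTotalOrder = record
    { isStrictPartialOrder = record
      { isEquivalence = ≡.isEquivalence
      ; irrefl        = Lex.<-irrefl ≺.irrefl ∘ ≡⇒Pointwise-≡
      ; trans         = Lex.<-trans (record { sym = sym ; trans = trans }) ≺.<-resp-≈ ≺.trans
      ; <-resp-≈      = ≡.resp₂ _
      }
    ; compare = compare
    }
    where
    compare : Trichotomous _≡_ (LexLt _≺_ {n})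
    compare xs ys with Lex.<-cmp sym ≺.compare xs ys
    ... | tri< a ¬b ¬c = tri< a (¬b ∘ ≡⇒Pointwise-≡) ¬c
    ... | tri≈ ¬a b ¬c = tri≈ ¬a (Pointwise-≡⇒≡ b) ¬c
    ... | tri> ¬a ¬b c = tri> ¬a (¬b ∘ ≡⇒Pointwise-≡) c

module _ {_<_ : Rel B 0ℓ} (<-isSTO : IsStrictTotalOrder _≡_ _<_) where
  private module < = IsStrictTotalOrder <-isSTO

  isStrictTotalOrder-on-injection : (f : A → B) → (∀ {x y} → f x ≡ f y → x ≡ y) →
                                    IsStrictTotalOrder _≡_ (_<_ on f)
  isStrictTotalOrder-on-injection f f-injective = record
    { isStrictPartialOrder = record
      { isEquivalence = ≡.isEquivalence
      ; irrefl        = <.irrefl ∘ cong f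
      ; trans         = <.trans
      ; <-resp-≈      = ≡.resp₂ _
      }
    ; compare = compare
    }
    where
    compare : Trichotomous _≡_ (_<_ on f)
    compare x y with <.compare (f x) (f y)
    ... | tri< a ¬b ¬c = tri< a (¬b ∘ cong f) ¬c
    ... | tri≈ ¬a b ¬c = tri≈ ¬a (f-injective b) ¬c
    ... | tri> ¬a ¬b c = tri> ¬a (¬b ∘ cong f) c

module Minimum {_<_ : Rel A 0ℓ} (<-isSTO : IsStrictTotalOrder _≡_ _<_) where
  private
    module < = IsStrictTotalOrder <-isSTO
    strictTotalOrder : StrictTotalOrder 0ℓ 0ℓ 0ℓ
    strictTotalOrder = record { isStrictTotalOrder = <-isSTO }
    module Extrema = Data.List.Extrema (DecTotalOrder.totalOrder (decTotalOrder strictTotalOrder))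

  open Extrema public using (min)

  -- The same shape as _≤ₚ_ in Defs, so that min-≼ proves _≤ₚ_ goals directly.
  _≼_ : Rel A 0ℓ
  x ≼ y = x ≡ y ⊎ x < y

  ≼-antisym : ∀ {x y} → x ≼ y → y ≼ x → x ≡ y
  ≼-antisym (inj₁ x≡y) _          = x≡y
  ≼-antisym (inj₂ _)   (inj₁ y≡x) = sym y≡x
  ≼-antisym (inj₂ x<y) (inj₂ y<x) = ⊥-elim (<.asym x<y y<x)

  ≼⇒≯ : ∀ {x y} → x ≼ y → ¬ y < x
  ≼⇒≯ (inj₁ refl) = <.irrefl refl
  ≼⇒≯ (inj₂ x<y)  = <.asym x<y

  min-∈ : ∀ x xs → min x xs ∈ x ∷ xs
  min-∈ x xs with Extrema.argmin-sel (λ y → y) x xs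
  ... | inj₁ min≡x  = here min≡x
  ... | inj₂ min∈xs = there min∈xs

  min-≼ : ∀ {x xs y} → y ∈ x ∷ xs → min x xs ≼ y
  min-≼ {x} {xs} (here refl) = Sum.swap (Extrema.min≤⊤ x xs)
  min-≼ {x} {xs} (there y∈)  = Sum.swap (All.lookup (Extrema.min≤xs x xs) y∈)

-- Rotations

rotateList : List A → List A
rotateList []       = []
rotateList (x ∷ xs) = xs ++ [ x ]

rotateListBy : ℕ → List A → List A
rotateListBy i xs = iterate rotateList xs i

toList-rot : ∀ i (xs : Vec A n) → toList (rot i xs) ≡ rotateListBy i (toList xs)
toList-rot zero    xs       = refl
toList-rot (suc i) []       = toList-rot i []
toList-rot (suc i) (x ∷ xs) = trans (toList-rot i (xs ∷ʳ x)) (cong (rotateListBy i) (Vecₚ.toList-∷ʳ x xs))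

rotateListBy-++ : (xs ys : List A) → rotateListBy (length xs) (xs ++ ys) ≡ ys ++ xs
rotateListBy-++ []       ys = sym (Listₚ.++-identityʳ ys)
rotateListBy-++ (x ∷ xs) ys = begin
  rotateListBy (length xs) ((xs ++ ys) ++ [ x ]) ≡⟨ cong (rotateListBy (length xs)) (Listₚ.++-assoc xs ys [ x ]) ⟩
  rotateListBy (length xs) (xs ++ ys ++ [ x ])   ≡⟨ rotateListBy-++ xs (ys ++ [ x ]) ⟩
  (ys ++ [ x ]) ++ xs                            ≡⟨ Listₚ.++-assoc ys [ x ] xs ⟩
  ys ++ x ∷ xs                                   ∎
  where open ≡-Reasoning

rot-+ : ∀ i j (xs : Vec A n) → rot i (rot j xs) ≡ rot (j + i) xs
rot-+ i zero    xs = refl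
rot-+ i (suc j) xs = rot-+ i j (rotate1 xs)

rot-period : (xs : Vec A n) → rot n xs ≡ xs
rot-period {n = n} xs = trans (sym (Vecₚ.cast-is-id refl (rot n xs))) (Vecₚ.toList-injective refl (rot n xs) xs (begin
  toList (rot n xs)                                ≡⟨ toList-rot n xs ⟩
  rotateListBy n ys                                ≡⟨ cong (λ l → rotateListBy l ys) (Vecₚ.length-toList xs) ⟨
  rotateListBy (length ys) ys                      ≡⟨ cong (rotateListBy (length ys)) (Listₚ.++-identityʳ ys) ⟨
  rotateListBy (length ys) (ys ++ [])              ≡⟨ rotateListBy-++ ys [] ⟩
  ys                                               ∎))
  where
  open ≡-Reasoning
  ys = toList xs

rot-*-period : ∀ q (xs : Vec A n) → rot (q * n) xs ≡ xs
rot-*-period zero    xs = refl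
rot-*-period {n = n} (suc q) xs = begin
  rot (n + q * n) xs     ≡⟨ rot-+ (q * n) n xs ⟨
  rot (q * n) (rot n xs) ≡⟨ cong (rot (q * n)) (rot-period xs) ⟩
  rot (q * n) xs         ≡⟨ rot-*-period q xs ⟩
  xs                     ∎
  where open ≡-Reasoning

rot-% : ∀ a (xs : Vec A (suc n)) → rot a xs ≡ rot (a % suc n) xs
rot-% {n = n} a xs = begin
  rot a xs                                     ≡⟨ cong (λ i → rot i xs) (m≡m%n+[m/n]*n a (suc n)) ⟩
  rot (a % suc n + a / suc n * suc n) xs       ≡⟨ rot-+ (a / suc n * suc n) (a % suc n) xs ⟨
  rot (a / suc n * suc n) (rot (a % suc n) xs) ≡⟨ rot-*-period (a / suc n) _ ⟩
  rot (a % suc n) xs                           ∎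
  where open ≡-Reasoning

rot-inverse : ∀ j (xs : Vec A (suc n)) → rot (j * n) (rot j xs) ≡ xs
rot-inverse {n = n} j xs = begin
  rot (j * n) (rot j xs) ≡⟨ rot-+ (j * n) j xs ⟩
  rot (j + j * n) xs     ≡⟨ cong (λ i → rot i xs) (ℕₚ.*-suc j n) ⟨
  rot (j * suc n) xs     ≡⟨ rot-*-period j xs ⟩
  xs                     ∎
  where open ≡-Reasoning

rot-map : ∀ i (f : A → B) (xs : Vec A n) → rot i (Vec.map f xs) ≡ Vec.map f (rot i xs)
rot-map zero    f xs       = refl
rot-map (suc i) f []       = rot-map i f []
rot-map (suc i) f (x ∷ xs) = trans (cong (rot i) (sym (Vecₚ.map-∷ʳ f x xs))) (rot-map i f (xs ∷ʳ x))

zipWith-∷ʳ : (f : A → B → C) (xs : Vec A n) (ys : Vec B n) (x : A) (y : B) →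
             zipWith f (xs ∷ʳ x) (ys ∷ʳ y) ≡ zipWith f xs ys ∷ʳ f x y
zipWith-∷ʳ f []        []        x y = refl
zipWith-∷ʳ f (x′ ∷ xs) (y′ ∷ ys) x y = cong (f x′ y′ ∷_) (zipWith-∷ʳ f xs ys x y)

rot-zipWith : ∀ i (f : A → B → C) (xs : Vec A n) (ys : Vec B n) →
              rot i (zipWith f xs ys) ≡ zipWith f (rot i xs) (rot i ys)
rot-zipWith zero    f xs       ys       = refl
rot-zipWith (suc i) f []       []       = rot-zipWith i f [] []
rot-zipWith (suc i) f (x ∷ xs) (y ∷ ys) =
  trans (cong (rot i) (sym (zipWith-∷ʳ f xs ys x y))) (rot-zipWith i f (xs ∷ʳ x) (ys ∷ʳ y))

rotations : Vec A n → List (Vec A n)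
rotations {n = n} xs = applyUpTo (λ i → rot i xs) n

∈-rotations⁺ : ∀ (xs : Vec A n) {i} → i < n → rot i xs ∈ rotations xs
∈-rotations⁺ xs = ∈-applyUpTo⁺ (λ i → rot i xs)

∈-rotations-∷⁻ : ∀ {xs ys : Vec A (suc n)} → ys ∈ xs ∷ rotations xs →
                 ∃[ i ] (i < suc n × rot i xs ≡ ys)
∈-rotations-∷⁻ (here ys≡xs) = 0 , s≤s z≤n , sym ys≡xs
∈-rotations-∷⁻ {xs = xs} (there ys∈) with ∈-applyUpTo⁻ (λ i → rot i xs) ys∈
... | i , i<n , ys≡ = i , i<n , sym ys≡

Equivariant : (Vec A n → Vec B n) → Set
Equivariant h = ∀ i xs → h (rot i xs) ≡ rot i (h xs)

map-equivariant : (f : A → B) → Equivariant {n = n} (Vec.map f)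
map-equivariant f i xs = sym (rot-map i f xs)

rot-equivariant : ∀ j → Equivariant {A = A} {n = n} (rot j)
rot-equivariant j i xs = begin
  rot j (rot i xs) ≡⟨ rot-+ j i xs ⟩
  rot (i + j) xs   ≡⟨ cong (λ l → rot l xs) (ℕₚ.+-comm i j) ⟩
  rot (j + i) xs   ≡⟨ rot-+ i j xs ⟨
  rot i (rot j xs) ∎
  where open ≡-Reasoning

Primitive : Vec A n → Set
Primitive {n = n} xs = ∀ i → 1 ≤ i → i < n → ¬ rot i xs ≡ xs

primitive-reflect : {h : Vec A n → Vec B n} → Equivariant h → ∀ {xs} → Primitive (h xs) → Primitive xs
primitive-reflect {h = h} h-equivariant {xs} prim i 1≤i i<n rot≡ =
  prim i 1≤i i<n (trans (sym (h-equivariant i xs)) (cong h rot≡))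

primitive-rot : ∀ j {xs : Vec A (suc n)} → Primitive xs → Primitive (rot j xs)
primitive-rot {n = n} j {xs} prim =
  primitive-reflect (rot-equivariant (j * n)) (subst Primitive (sym (rot-inverse j xs)) prim)

replicate-+ : ∀ i j (x : A) → List.replicate (i + j) x ≡ List.replicate i x ++ List.replicate j x
replicate-+ zero    j x = refl
replicate-+ (suc i) j x = cong (x ∷_) (replicate-+ i j x)

-- Rotating a bⁿ by i + 1 ≤ n brings the block b^(n-i) to the front, so the head becomes b.
∷-replicate-primitive : ∀ {a b : A} → ¬ a ≡ b → Primitive (a ∷ replicate n b)
∷-replicate-primitive {n = n} {a} {b} a≢b (suc i) _ (s≤s i<n) rot≡ =
  a≢b (sym (Listₚ.∷-injectiveˡ (begin
    b ∷ List.replicate d b ++ a ∷ List.replicate i b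
      ≡⟨ rotateListBy-++ (a ∷ List.replicate i b) (b ∷ List.replicate d b) ⟨
    rotateListBy (suc (length (List.replicate i b))) (a ∷ List.replicate i b ++ b ∷ List.replicate d b)
      ≡⟨ cong₂ (λ l xs → rotateListBy (suc l) (a ∷ xs))
               (Listₚ.length-replicate i) (sym (replicate-+ i (suc d) b)) ⟩
    rotateListBy (suc i) (a ∷ List.replicate (i + suc d) b)
      ≡⟨ cong (λ l → rotateListBy (suc i) (a ∷ List.replicate l b)) n≡i+suc-d ⟨
    rotateListBy (suc i) (a ∷ List.replicate n b)
      ≡⟨ cong (λ xs → rotateListBy (suc i) (a ∷ xs)) (Vecₚ.toList-replicate n b) ⟨
    rotateListBy (suc i) (toList (a ∷ replicate n b))
      ≡⟨ toList-rot (suc i) (a ∷ replicate n b) ⟨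
    toList (rot (suc i) (a ∷ replicate n b))
      ≡⟨ cong toList rot≡ ⟩
    a ∷ toList (replicate n b) ∎)))
  where
  open ≡-Reasoning
  d = n ∸ suc i
  n≡i+suc-d : n ≡ i + suc d
  n≡i+suc-d = trans (sym (ℕₚ.m+[n∸m]≡n i<n)) (sym (ℕₚ.+-suc i d))

-- Rows and columns

map-map : ∀ {f : B → C} {g : A → B} {h : A → C} → (∀ x → f (g x) ≡ h x) →
          (xs : Vec A n) → Vec.map f (Vec.map g xs) ≡ Vec.map h xs
map-map {f = f} {g} f∘g≗h xs = trans (sym (Vecₚ.map-∘ f g xs)) (Vecₚ.map-cong f∘g≗h xs)

map-zipWith-projˡ : ∀ {f : A → B → C} {g : C → A} → (∀ x y → g (f x y) ≡ x) →
                    (xs : Vec A n) (ys : Vec B n) → Vec.map g (zipWith f xs ys) ≡ xs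
map-zipWith-projˡ g∘f []       []       = refl
map-zipWith-projˡ g∘f (x ∷ xs) (y ∷ ys) = cong₂ _∷_ (g∘f x y) (map-zipWith-projˡ g∘f xs ys)

map-zipWith-projʳ : ∀ {f : A → B → C} {g : C → B} → (∀ x y → g (f x y) ≡ y) →
                    (xs : Vec A n) (ys : Vec B n) → Vec.map g (zipWith f xs ys) ≡ ys
map-zipWith-projʳ g∘f []       []       = refl
map-zipWith-projʳ g∘f (x ∷ xs) (y ∷ ys) = cong₂ _∷_ (g∘f x y) (map-zipWith-projʳ g∘f xs ys)

zipWith-map-map : ∀ {f : A → B → C} {g : C → A} {h : C → B} → (∀ z → f (g z) (h z) ≡ z) →
                  (zs : Vec C n) → zipWith f (Vec.map g zs) (Vec.map h zs) ≡ zs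
zipWith-map-map f∘⟨g,h⟩ []       = refl
zipWith-map-map f∘⟨g,h⟩ (z ∷ zs) = cong₂ _∷_ (f∘⟨g,h⟩ z) (zipWith-map-map f∘⟨g,h⟩ zs)

init-∷ʳ-last : (xs : Vec A (suc n)) → init xs ∷ʳ last xs ≡ xs
init-∷ʳ-last xs = sym (proj₂ (proj₂ (Vec.initLast xs)))

init-rotate1 : (xs : Vec A (suc n)) → init (rotate1 xs) ≡ tail xs
init-rotate1 (x ∷ xs) = Vecₚ.init-∷ʳ x xs

rotate1-rot : (xs : Vec A (suc n)) → rotate1 (rot n xs) ≡ xs
rotate1-rot {n = n} xs = trans (rot-+ 1 n xs) (trans (cong (λ i → rot i xs) (ℕₚ.+-comm n 1)) (rot-period xs))

tail-rot : (xs : Vec A (suc n)) → tail (rot n xs) ≡ init xs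
tail-rot {n = n} xs = trans (sym (init-rotate1 (rot n xs))) (cong init (rotate1-rot xs))

colPat-injective : ∀ {k} {R R′ : Column k n} → colPat R ≡ colPat R′ → R ≡ R′
colPat-injective {R = []}    {[]}      _    = refl
colPat-injective {R = r ∷ R} {r′ ∷ R′} r∷R≡ with Vecₚ.∷-injective r∷R≡
... | refl , R≡R′ = cong (r ∷_) (colPat-injective R≡R′)

module _ {k : ℕ} where

  dropLast dropFirst : Pattern k n (suc w) → Pattern k n w
  dropLast  = Vec.map init
  dropFirst = Vec.map tail

  firstColumn lastColumn : Pattern k n (suc w) → Column k n
  firstColumn = Vec.map head
  lastColumn  = Vec.map last

  dropLast-[,]ʳ : (P : Pattern k n w) (R : Column k n) → dropLast [ P , R ]ʳ ≡ P
  dropLast-[,]ʳ = map-zipWith-projˡ (λ r a → Vecₚ.init-∷ʳ a r)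

  lastColumn-[,]ʳ : (P : Pattern k n w) (R : Column k n) → lastColumn [ P , R ]ʳ ≡ R
  lastColumn-[,]ʳ = map-zipWith-projʳ (λ r a → Vecₚ.last-∷ʳ a r)

  [dropLast,lastColumn]ʳ : (X : Pattern k n (suc w)) → [ dropLast X , lastColumn X ]ʳ ≡ X
  [dropLast,lastColumn]ʳ = zipWith-map-map init-∷ʳ-last

  dropFirst-[,]ˡ : (L : Column k n) (P : Pattern k n w) → dropFirst [ L , P ]ˡ ≡ P
  dropFirst-[,]ˡ = map-zipWith-projʳ (λ _ _ → refl)

  [firstColumn,dropFirst]ˡ : (X : Pattern k n (suc w)) → [ firstColumn X , dropFirst X ]ˡ ≡ X
  [firstColumn,dropFirst]ˡ = zipWith-map-map λ { (x ∷ r) → refl }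

  [,]ˡ-[,]ʳ : (L : Column k n) (C : Pattern k n w) (R : Column k n) →
              [ L , [ C , R ]ʳ ]ˡ ≡ [ [ L , C ]ˡ , R ]ʳ
  [,]ˡ-[,]ʳ []      []      []      = refl
  [,]ˡ-[,]ʳ (l ∷ L) (r ∷ C) (a ∷ R) = cong (_ ∷_) ([,]ˡ-[,]ʳ L C R)

  dropFirst-[,]ʳ : (P : Pattern k n (suc w)) (R : Column k n) → dropFirst [ P , R ]ʳ ≡ [ dropFirst P , R ]ʳ
  dropFirst-[,]ʳ []            []      = refl
  dropFirst-[,]ʳ ((x ∷ r) ∷ P) (a ∷ R) = cong (_ ∷_) (dropFirst-[,]ʳ P R)

  [firstColumn,[dropFirst,R]ʳ]ˡ : (P : Pattern k n (suc w)) (R : Column k n) →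
                                  [ firstColumn P , [ dropFirst P , R ]ʳ ]ˡ ≡ [ P , R ]ʳ
  [firstColumn,[dropFirst,R]ʳ]ˡ P R =
    trans ([,]ˡ-[,]ʳ (firstColumn P) (dropFirst P) R) (cong (λ X → [ X , R ]ʳ) ([firstColumn,dropFirst]ˡ P))

  shiftColumnsLeft shiftColumnsRight : Pattern k n (suc w) → Pattern k n (suc w)
  shiftColumnsLeft          = Vec.map rotate1
  shiftColumnsRight {w = w} = Vec.map (rot w)

  shiftColumnsLeft-Right : (X : Pattern k n (suc w)) → shiftColumnsLeft (shiftColumnsRight X) ≡ X
  shiftColumnsLeft-Right X = trans (map-map rotate1-rot X) (Vecₚ.map-id X)

  shiftColumnsRight-Left : (X : Pattern k n (suc w)) → shiftColumnsRight (shiftColumnsLeft X) ≡ X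
  shiftColumnsRight-Left X = trans (map-map rot-period X) (Vecₚ.map-id X)

  dropFirst-shiftColumnsRight : (X : Pattern k n (suc w)) → dropFirst (shiftColumnsRight X) ≡ dropLast X
  dropFirst-shiftColumnsRight = map-map tail-rot

shiftIn : A → Vec A n → Vec A n
shiftIn a xs = tail (xs ∷ʳ a)

shiftIn-∷ʳ : (a : A) (xs : Vec A n) → shiftIn a (xs ∷ʳ a) ≡ shiftIn a xs ∷ʳ a
shiftIn-∷ʳ a []       = refl
shiftIn-∷ʳ a (x ∷ xs) = refl

iterate-shiftIn-∷ʳ : ∀ j (a : A) (xs : Vec A n) →
                     iterate (shiftIn a) (xs ∷ʳ a) j ≡ iterate (shiftIn a) xs j ∷ʳ a
iterate-shiftIn-∷ʳ zero    a xs = refl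
iterate-shiftIn-∷ʳ (suc j) a xs =
  trans (cong (λ ys → iterate (shiftIn a) ys j) (shiftIn-∷ʳ a xs)) (iterate-shiftIn-∷ʳ j a (shiftIn a xs))

replicate-∷ʳ : ∀ n (a : A) → replicate n a ∷ʳ a ≡ a ∷ replicate n a
replicate-∷ʳ zero    a = refl
replicate-∷ʳ (suc n) a = cong (a ∷_) (replicate-∷ʳ n a)

iterate-shiftIn-length : (a : A) (xs : Vec A n) → iterate (shiftIn a) xs n ≡ replicate n a
iterate-shiftIn-length a []                   = refl
iterate-shiftIn-length {n = suc n} a (x ∷ xs) = begin
  iterate (shiftIn a) (xs ∷ʳ a) n ≡⟨ iterate-shiftIn-∷ʳ n a xs ⟩
  iterate (shiftIn a) xs n ∷ʳ a   ≡⟨ cong (_∷ʳ a) (iterate-shiftIn-length a xs) ⟩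
  replicate n a ∷ʳ a              ≡⟨ replicate-∷ʳ n a ⟩
  a ∷ replicate n a               ∎
  where open ≡-Reasoning

shiftInColumn : Vec A n → Vec (Vec A w) n → Vec (Vec A w) n
shiftInColumn as xss = Vec.map tail (zipWith _∷ʳ_ xss as)

iterate-shiftInColumn : ∀ j (a : A) (as : Vec A n) (xs : Vec A w) xss →
  iterate (shiftInColumn (a ∷ as)) (xs ∷ xss) j ≡ iterate (shiftIn a) xs j ∷ iterate (shiftInColumn as) xss j
iterate-shiftInColumn zero    a as xs xss = refl
iterate-shiftInColumn (suc j) a as xs xss = iterate-shiftInColumn j a as (shiftIn a xs) (shiftInColumn as xss)

iterate-shiftInColumn-width : (as : Vec A n) (xss : Vec (Vec A w) n) →
                              iterate (shiftInColumn as) xss w ≡ Vec.map (replicate w) as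
iterate-shiftInColumn-width [] [] = Vec0-unique _
  where
  Vec0-unique : (v : Vec (Vec A w) 0) → v ≡ []
  Vec0-unique [] = refl
iterate-shiftInColumn-width {w = w} (a ∷ as) (xs ∷ xss) =
  trans (iterate-shiftInColumn w a as xs xss)
        (cong₂ _∷_ (iterate-shiftIn-length a xs) (iterate-shiftInColumn-width as xss))

-- Lists and permutations

∈⇒↭∷ : ∀ {x : A} {xs} → x ∈ xs → ∃ λ ys → xs ↭ x ∷ ys
∈⇒↭∷ x∈xs with ∈-∃++ x∈xs
... | ys , zs , refl = ys ++ zs , shift _ ys zs

↭-swap-drop : ∀ {x y : A} {xs ys} → x ∷ y ∷ xs ↭ y ∷ ys → x ∷ xs ↭ ys
↭-swap-drop p = drop-∷ (↭-trans (↭-swap _ _ ↭-refl) p)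

++-cancelˡ-↭ : ∀ (xs : List A) {ys zs} → xs ++ ys ↭ xs ++ zs → ys ↭ zs
++-cancelˡ-↭ []       p = p
++-cancelˡ-↭ (x ∷ xs) p = ++-cancelˡ-↭ xs (drop-∷ p)

unique-map-injectiveOn : ∀ {f : A → B} {xs} → (∀ {x y} → x ∈ xs → y ∈ xs → f x ≡ f y → x ≡ y) →
                         Unique xs → Unique (map f xs)
unique-map-injectiveOn inj []           = []
unique-map-injectiveOn inj (x∉xs ∷ xs!) =
  Allₚ.map⁺ (All.tabulate λ y∈xs fx≡fy → All.lookup x∉xs y∈xs (inj (here refl) (there y∈xs) fx≡fy))
  ∷ unique-map-injectiveOn (λ x∈ y∈ → inj (there x∈) (there y∈)) xs!

map-↭-of-bijectionOn : ∀ {f g : A → A} {xs} → Unique xs →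
                       (∀ {x} → x ∈ xs → f x ∈ xs) → (∀ {x} → x ∈ xs → g x ∈ xs) →
                       (∀ {x} → x ∈ xs → g (f x) ≡ x) → (∀ {x} → x ∈ xs → f (g x) ≡ x) →
                       map f xs ↭ xs
map-↭-of-bijectionOn {f = f} {g} {xs} xs! f∈ g∈ g∘f f∘g =
  ∼bag⇒↭ (unique∧set⇒bag (unique-map-injectiveOn injective xs!) xs! (mk⇔ to from))
  where
  injective : ∀ {x y} → x ∈ xs → y ∈ xs → f x ≡ f y → x ≡ y
  injective x∈ y∈ fx≡fy = trans (sym (g∘f x∈)) (trans (cong g fx≡fy) (g∘f y∈))
  to : ∀ {y} → y ∈ map f xs → y ∈ xs
  to y∈ with ∈-map⁻ f y∈
  ... | x , x∈ , refl = f∈ x∈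
  from : ∀ {y} → y ∈ xs → y ∈ map f xs
  from y∈ = subst (_∈ map f xs) (f∘g y∈) (∈-map⁺ f (g∈ y∈))

length-filter-map : ∀ {P : Pred B 0ℓ} (P? : Decidable P) (f : A → B) xs →
                    length (filter P? (map f xs)) ≡ length (filter (P? ∘ f) xs)
length-filter-map P? f []       = refl
length-filter-map P? f (x ∷ xs) with does (P? (f x))
... | true  = cong suc (length-filter-map P? f xs)
... | false = length-filter-map P? f xs

allVecs : List A → ∀ n → List (Vec A n)
allVecs xs zero    = [ [] ]
allVecs xs (suc n) = cartesianProductWith _∷_ xs (allVecs xs n)

∈-allVecs : ∀ {xs : List A} → (∀ x → x ∈ xs) → (v : Vec A n) → v ∈ allVecs xs n
∈-allVecs all∈ []      = here refl
∈-allVecs all∈ (x ∷ v) = ∈-cartesianProductWith⁺ _∷_ (all∈ x) (∈-allVecs all∈ v)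

-- Euler circuits of balanced digraphs

module EulerCircuit {V E : Set} (_≟_ : DecidableEquality V) (src tgt : E → V) where

  open import Data.List.Membership.DecPropositional _≟_ using (_∈?_)

  Walk : V → List E → V → Set
  Walk u []       v = u ≡ v
  Walk u (e ∷ es) v = src e ≡ u × Walk (tgt e) es v

  -- Multiset form of "in-degree = out-degree at every vertex".
  Balanced : List E → Set
  Balanced es = map src es ↭ map tgt es

  private variable
    a b x y : V
    e : E
    W R : List E

  walk-++ : ∀ {W′} → Walk a W b → Walk b W′ x → Walk a (W ++ W′) x
  walk-++ {W = []}    refl    w′ = w′
  walk-++ {W = e ∷ W} (s , w) w′ = s , walk-++ w w′

  walk-endpoints : Walk a W b → a ∷ map tgt W ↭ b ∷ map src W
  walk-endpoints {W = []}    refl       = ↭-refl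
  walk-endpoints {W = e ∷ W} (refl , w) = ↭-trans (↭-prep (src e) (walk-endpoints w)) (↭-swap _ _ ↭-refl)

  walk-start-∈ : Walk a W b → a ∈ b ∷ map src W
  walk-start-∈ {W = []}    refl       = here refl
  walk-start-∈ {W = e ∷ W} (refl , _) = there (here refl)

  closed-walk-balanced : Walk a W a → Balanced W
  closed-walk-balanced w = ↭-sym (drop-∷ (walk-endpoints w))

  balanced-↭ : ∀ {R′} → R ↭ R′ → Balanced R → Balanced R′
  balanced-↭ p bal = ↭-trans (↭-sym (map⁺ src p)) (↭-trans bal (map⁺ tgt p))

  balanced-cancelˡ : Balanced W → Balanced (W ++ R) → Balanced R
  balanced-cancelˡ {W} {R} balW balWR = ++-cancelˡ-↭ (map src W) (begin
    map src W ++ map src R ≡⟨ Listₚ.map-++ src W R ⟨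
    map src (W ++ R)       ↭⟨ balWR ⟩
    map tgt (W ++ R)       ≡⟨ Listₚ.map-++ tgt W R ⟩
    map tgt W ++ map tgt R ↭⟨ ++⁺ʳ (map tgt R) (↭-sym balW) ⟩
    map src W ++ map tgt R ∎)
    where open PermutationReasoning

  balanced-of-reversal : ∀ (φ : E → E) → map φ R ↭ R → (∀ {e} → e ∈ R → tgt (φ e) ≡ src e) →
                         Balanced R
  balanced-of-reversal {R} φ φR↭R tgt∘φ≡src = begin
    map src R         ≡⟨ Listₚ.map-cong-local (All.tabulate tgt∘φ≡src) ⟨
    map (tgt ∘ φ) R   ≡⟨ Listₚ.map-∘ R ⟩
    map tgt (map φ R) ↭⟨ map⁺ tgt φR↭R ⟩
    map tgt R         ∎
    where open PermutationReasoning

  balanced-degrees : Balanced R → ∀ v →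
                     length (filter (λ e → src e ≟ v) R) ≡ length (filter (λ e → tgt e ≟ v) R)
  balanced-degrees {R} bal v = begin
    length (filter (λ e → src e ≟ v) R) ≡⟨ length-filter-map (_≟ v) src R ⟨
    length (filter (_≟ v) (map src R))  ≡⟨ ↭-length (filter-↭ (_≟ v) bal) ⟩
    length (filter (_≟ v) (map tgt R))  ≡⟨ length-filter-map (_≟ v) tgt R ⟩
    length (filter (λ e → tgt e ≟ v) R) ∎
    where open ≡-Reasoning

  out-edge-of-unbalanced : ¬ y ≡ x → x ∷ map src R ↭ y ∷ map tgt R → ∃ λ e → e ∈ R × src e ≡ y
  out-edge-of-unbalanced y≢x bal with ∈-resp-↭ (↭-sym bal) (here refl)
  ... | here y≡x = ⊥-elim (y≢x y≡x)
  ... | there y∈ with ∈-map⁻ src y∈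
  ... | e , e∈R , y≡src = e , e∈R , sym y≡src

  -- If an extra edge x → y would balance R, then R contains a trail from y back to x.
  closing-trail : ∀ R → Acc _<_ (length R) → x ∷ map src R ↭ y ∷ map tgt R →
                  ∃₂ λ P Rest → R ↭ P ++ Rest × Walk y P x
  closing-trail {x} {y} R (acc rec) bal with y ≟ x
  ... | yes y≡x = [] , R , ↭-refl , y≡x
  ... | no  y≢x with out-edge-of-unbalanced y≢x bal
  ... | e , e∈R , refl with ∈⇒↭∷ e∈R
  ... | R′ , R↭ with closing-trail R′ (rec (ℕₚ.≤-reflexive (sym (↭-length R↭)))) (↭-swap-drop (begin
        x ∷ src e ∷ map src R′     ↭⟨ ↭-prep x (map⁺ src R↭) ⟨
        x ∷ map src R              ↭⟨ bal ⟩
        src e ∷ map tgt R          ↭⟨ ↭-prep (src e) (map⁺ tgt R↭) ⟩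
        src e ∷ tgt e ∷ map tgt R′ ∎))
    where open PermutationReasoning
  ... | P , Rest , R′↭ , w = e ∷ P , Rest , ↭-trans R↭ (↭-prep e R′↭) , refl , w

  closed-trail : e ∈ R → Balanced R →
                 ∃₂ λ C Rest → R ↭ (e ∷ C) ++ Rest × Walk (src e) (e ∷ C) (src e)
  closed-trail {e} e∈R bal with ∈⇒↭∷ e∈R
  ... | R′ , R↭ with closing-trail R′ (<-wellFounded _) (balanced-↭ R↭ bal)
  ... | C , Rest , R′↭ , w = C , Rest , ↭-trans R↭ (↭-prep e R′↭) , refl , w

  walk-enters : ∀ (S : List V) → Walk x W y → y ∈ S →
                x ∈ S ⊎ ∃ λ f → f ∈ W × src f ∉ S × tgt f ∈ S
  walk-enters {W = []} S refl y∈S = inj₁ y∈S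
  walk-enters {x} {W = f ∷ W} S (s , w) y∈S with x ∈? S
  ... | yes x∈S = inj₁ x∈S
  ... | no  x∉S with walk-enters S w y∈S
  ...   | inj₁ tf∈S                    = inj₂ (f , here refl , subst (_∉ S) (sym s) x∉S , tf∈S)
  ...   | inj₂ (g , g∈W , sg∉S , tg∈S) = inj₂ (g , there g∈W , sg∉S , tg∈S)

  split-walk : Walk a W b → x ∈ a ∷ map src W →
               ∃₂ λ W₁ W₂ → W ≡ W₁ ++ W₂ × Walk a W₁ x × Walk x W₂ b
  split-walk w (here refl) = [] , _ , refl , refl , w
  split-walk {W = e ∷ W} (s , w) (there (here refl)) = [] , e ∷ W , refl , sym s , refl , w
  split-walk {W = e ∷ W} (s , w) (there (there x∈)) with split-walk w (there x∈)
  ... | W₁ , W₂ , refl , w₁ , w₂ = e ∷ W₁ , W₂ , refl , (s , w₁) , w₂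

  rotate-closed-walk : Walk a W a → x ∈ a ∷ map src W →
                       ∃ λ W′ → W ↭ W′ × Walk x W′ x × (a ∷ map src W ⊆ x ∷ map src W′)
  rotate-closed-walk w x∈ with split-walk w x∈
  ... | W₁ , W₂ , refl , w₁ , w₂ = W₂ ++ W₁ , ++-comm W₁ W₂ , walk-++ w₂ w₁ , vertices⊆
    where
    vertices⊆ : _ ∷ map src (W₁ ++ W₂) ⊆ _ ∷ map src (W₂ ++ W₁)
    vertices⊆ (here refl) with walk-start-∈ w₁
    ... | here a≡x = here a≡x
    ... | there a∈ = there (subst (_ ∈_) (sym (Listₚ.map-++ src W₂ W₁)) (∈-++⁺ʳ (map src W₂) a∈))
    vertices⊆ (there y∈) = there (∈-resp-↭ (map⁺ src (++-comm W₁ W₂)) y∈)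

  module _ (es : List E) (u : V)
           (reaches : ∀ {e} → e ∈ es → ∃ λ ws → ws ⊆ es × Walk (src e) ws u) where

    -- A walk from an unused edge r to u either starts on W or enters W through an unused
    -- edge; balance of the unused edges R then gives an unused edge leaving W.
    unused-edge-from-walk : ∀ {r} → es ↭ W ++ R → Balanced R → u ∈ a ∷ map src W → r ∈ R →
                            ∃ λ g → g ∈ R × src g ∈ a ∷ map src W
    unused-edge-from-walk {W} {R} {a} {r} es↭ bal u∈ r∈R
      with reaches (∈-resp-↭ (↭-sym es↭) (∈-++⁺ʳ W r∈R))
    ... | ws , ws⊆es , w with walk-enters (a ∷ map src W) w u∈
    ... | inj₁ sr∈ = r , r∈R , sr∈
    ... | inj₂ (f , f∈ws , sf∉ , tf∈) with ∈-++⁻ W (∈-resp-↭ es↭ (ws⊆es f∈ws))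
    ...   | inj₁ f∈W = ⊥-elim (sf∉ (there (∈-map⁺ src f∈W)))
    ...   | inj₂ f∈R with ∈-map⁻ src (∈-resp-↭ (↭-sym bal) (∈-map⁺ tgt f∈R))
    ...     | g , g∈R , tf≡sg = g , g∈R , subst (_∈ a ∷ map src W) tf≡sg tf∈

    -- Invariant: W is a closed walk through u, and R holds the edges not yet on it.
    splice : ∀ R → Acc _<_ (length R) → es ↭ W ++ R → Walk a W a → Balanced R → u ∈ a ∷ map src W →
             ∃ λ ws → es ↭ ws × ∃ λ b → Walk b ws b
    splice {W} {a} [] _ es↭ w _ _ = W , ↭-trans es↭ (↭-reflexive (Listₚ.++-identityʳ W)) , a , w
    splice {W} {a} (r ∷ R) (acc rec) es↭ w bal u∈ with unused-edge-from-walk es↭ bal u∈ (here refl)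
    ... | g , g∈ , sg∈ with rotate-closed-walk w sg∈ | closed-trail g∈ bal
    ... | W′ , W↭ , w′ , vertices⊆ | C , Rest , R↭ , cycle =
      splice Rest (rec shorter) es↭′ (walk-++ cycle w′)
             (balanced-cancelˡ (closed-walk-balanced cycle) (balanced-↭ R↭ bal)) u∈′
      where
      shorter : length Rest < length (r ∷ R)
      shorter = ℕₚ.≤-trans (s≤s (ℕₚ.m≤n+m (length Rest) (length C)))
                  (ℕₚ.≤-reflexive (sym (trans (↭-length R↭) (cong suc (Listₚ.length-++ C)))))
      es↭′ : es ↭ ((g ∷ C) ++ W′) ++ Rest
      es↭′ = begin
        es                      ↭⟨ es↭ ⟩
        W ++ r ∷ R              ↭⟨ ++⁺ʳ (r ∷ R) W↭ ⟩
        W′ ++ r ∷ R             ↭⟨ ++⁺ˡ W′ R↭ ⟩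
        W′ ++ (g ∷ C) ++ Rest   ↭⟨ shifts W′ (g ∷ C) ⟩
        (g ∷ C) ++ W′ ++ Rest   ≡⟨ Listₚ.++-assoc (g ∷ C) W′ Rest ⟨
        ((g ∷ C) ++ W′) ++ Rest ∎
        where open PermutationReasoning
      u∈′ : u ∈ src g ∷ map src ((g ∷ C) ++ W′)
      u∈′ with vertices⊆ u∈
      ... | here u≡sg  = here u≡sg
      ... | there u∈W′ =
        there (subst (u ∈_) (sym (Listₚ.map-++ src (g ∷ C) W′)) (∈-++⁺ʳ (map src (g ∷ C)) u∈W′))

    eulerian-circuit : Balanced es → ∃ λ ws → es ↭ ws × ∃ λ b → Walk b ws b
    eulerian-circuit bal = splice es (<-wellFounded _) ↭-refl refl bal (here refl)

-- Necklaces and row-Lyndon patterns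

module Necklaces (k m′ : ℕ) where

  m : ℕ
  m = suc m′

  private variable
    S Q Q′ : Pattern k m w

  <ₚ-isStrictTotalOrder : IsStrictTotalOrder _≡_ (_<ₚ_ {k} {m} {w})
  <ₚ-isStrictTotalOrder = LexLt-isStrictTotalOrder (LexLt-isStrictTotalOrder Finₚ.<-isStrictTotalOrder)

  module Pat {w} = Minimum (<ₚ-isStrictTotalOrder {w})

  _≟ₚ_ : DecidableEquality (Pattern k m w)
  _≟ₚ_ = IsStrictTotalOrder._≟_ <ₚ-isStrictTotalOrder

  -- Opaque: only lexmin-isLexmin is used, and unfolding the minimum is very expensive.
  opaque
    lexmin : Pattern k m w → Pattern k m w
    lexmin S = Pat.min S (rotations S)

    lexmin-isLexmin : (S : Pattern k m w) → IsLexmin S (lexmin S)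
    lexmin-isLexmin S = ∈-rotations-∷⁻ (Pat.min-∈ S (rotations S)) ,
                        λ i i<m → Pat.min-≼ (there (∈-rotations⁺ S i<m))

  isLexmin-≤ₚ-rot : IsLexmin S Q → ∀ a → Q ≤ₚ rot a S
  isLexmin-≤ₚ-rot {S = S} {Q} (_ , least) a = subst (Q ≤ₚ_) (sym (rot-% a S)) (least (a % m) (m%n<n a m))

  isLexmin-unique : IsLexmin S Q → IsLexmin S Q′ → Q ≡ Q′
  isLexmin-unique ((i , i<m , rotᵢ≡Q) , Q≤) ((j , j<m , rotⱼ≡Q′) , Q′≤) =
    Pat.≼-antisym (subst (_ ≤ₚ_) rotⱼ≡Q′ (Q≤ j j<m)) (subst (_ ≤ₚ_) rotᵢ≡Q (Q′≤ i i<m))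

  isLexmin⇒≡lexmin : IsLexmin S Q → Q ≡ lexmin S
  isLexmin⇒≡lexmin {S = S} isQ = isLexmin-unique isQ (lexmin-isLexmin S)

  ≡lexmin⇒isLexmin : lexmin S ≡ Q → IsLexmin S Q
  ≡lexmin⇒isLexmin {S = S} refl = lexmin-isLexmin S

  isLexmin-rot : IsLexmin S Q → ∀ j → IsLexmin (rot j S) Q
  isLexmin-rot {S = S} {Q} isQ@((i , _ , rotᵢ≡Q) , _) j =
    (i′ % m , m%n<n i′ m , rotates-to-Q) ,
    λ a _ → subst (Q ≤ₚ_) (sym (rot-+ a j S)) (isLexmin-≤ₚ-rot isQ (j + a))
    where
    i′ = j * m′ + i
    rotates-to-Q : rot (i′ % m) (rot j S) ≡ Q
    rotates-to-Q = begin
      rot (i′ % m) (rot j S)         ≡⟨ rot-% i′ (rot j S) ⟨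
      rot (j * m′ + i) (rot j S)     ≡⟨ rot-+ i (j * m′) (rot j S) ⟨
      rot i (rot (j * m′) (rot j S)) ≡⟨ cong (rot i) (rot-inverse j S) ⟩
      rot i S                        ≡⟨ rotᵢ≡Q ⟩
      Q                              ∎
      where open ≡-Reasoning

  lexmin-rot : ∀ j (S : Pattern k m w) → lexmin (rot j S) ≡ lexmin S
  lexmin-rot j S = sym (isLexmin⇒≡lexmin (isLexmin-rot (lexmin-isLexmin S) j))

  lexmin-isLexmin-self : (S : Pattern k m w) → IsLexmin (lexmin S) (lexmin S)
  lexmin-isLexmin-self S =
    let (i , _ , rotᵢ≡) = proj₁ (lexmin-isLexmin S) in
    subst (λ X → IsLexmin X (lexmin S)) rotᵢ≡ (isLexmin-rot (lexmin-isLexmin S) i)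

  lexmin-idem : (S : Pattern k m w) → lexmin (lexmin S) ≡ lexmin S
  lexmin-idem S = sym (isLexmin⇒≡lexmin (lexmin-isLexmin-self S))

  lexmin-equivariant : ∀ {w′} {h : Pattern k m w → Pattern k m w′} → Equivariant h →
                       ∀ X → lexmin (h (lexmin X)) ≡ lexmin (h X)
  lexmin-equivariant {h = h} h-equivariant X =
    let (i , _ , rotᵢ≡) = proj₁ (lexmin-isLexmin X) in begin
      lexmin (h (lexmin X)) ≡⟨ cong (lexmin ∘ h) rotᵢ≡ ⟨
      lexmin (h (rot i X))  ≡⟨ cong lexmin (h-equivariant i X) ⟩
      lexmin (rot i (h X))  ≡⟨ lexmin-rot i (h X) ⟩
      lexmin (h X)          ∎
    where open ≡-Reasoning

  primitive-lexmin : Primitive S → Primitive (lexmin S)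
  primitive-lexmin {S = S} prim =
    let (i , _ , rotᵢ≡) = proj₁ (lexmin-isLexmin S) in subst Primitive rotᵢ≡ (primitive-rot i prim)

  rowLyndon⇒primitive : RowLyndon Q → Primitive Q
  rowLyndon⇒primitive {Q = Q} lyn i 1≤i i<m rot≡Q =
    IsStrictTotalOrder.irrefl <ₚ-isStrictTotalOrder refl (subst (Q <ₚ_) rot≡Q (lyn i 1≤i i<m))

  rowLyndon⇒lexmin-fixed : RowLyndon Q → lexmin Q ≡ Q
  rowLyndon⇒lexmin-fixed {Q = Q} lyn = sym (isLexmin⇒≡lexmin ((0 , s≤s z≤n , refl) , least))
    where
    least : ∀ i → i < m → Q ≤ₚ rot i Q
    least zero    _   = inj₁ refl
    least (suc i) i<m = inj₂ (lyn (suc i) (s≤s z≤n) i<m)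

  primitive⇒rowLyndon-lexmin : Primitive S → RowLyndon (lexmin S)
  primitive⇒rowLyndon-lexmin {S = S} prim i 1≤i i<m =
    Sum.[ (λ lexmin≡rot → ⊥-elim (primitive-lexmin prim i 1≤i i<m (sym lexmin≡rot))) ,
          (λ lexmin<rot → lexmin<rot) ]′
      (proj₂ (lexmin-isLexmin-self S) i i<m)

  rowLyndon? : (Q : Pattern k m w) → Dec (RowLyndon Q)
  rowLyndon? Q = Dec.map′ (λ lyn i 1≤i i<m → lyn i<m 1≤i) (λ lyn {i} i<m 1≤i → lyn i 1≤i i<m)
    (ℕₚ.allUpTo? (λ i → 1 ℕ.≤? i →-dec IsStrictTotalOrder._<?_ <ₚ-isStrictTotalOrder Q (rot i Q)) m)

  <c-isStrictTotalOrder : IsStrictTotalOrder _≡_ (_<c_ {k} {m})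
  <c-isStrictTotalOrder = isStrictTotalOrder-on-injection <ₚ-isStrictTotalOrder colPat colPat-injective

  module Col = Minimum <c-isStrictTotalOrder

  -- The ring graph

  module Ring (c : ℕ) where
    open RingGraph k m c
    module Euler = EulerCircuit _≟ₚ_ src tgt

    Window : Set
    Window = Pattern k m (suc (suc c))

    private variable
      P P₂ : VPat
      R : Column k m
      W : Window
      e : Edge

    isVertex⇒lexmin-fixed : IsVertex P → lexmin P ≡ P
    isVertex⇒lexmin-fixed {P} (S , isP) = begin
      lexmin P          ≡⟨ cong lexmin (isLexmin⇒≡lexmin isP) ⟩
      lexmin (lexmin S) ≡⟨ lexmin-idem S ⟩
      lexmin S          ≡⟨ isLexmin⇒≡lexmin isP ⟨
      P                 ∎
      where open ≡-Reasoning

    IsLeastLabel : VPat → Column k m → Set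
    IsLeastLabel P R = ∀ {R′} → R′ <c R → ¬ lexmin [ P , R′ ]ʳ ≡ lexmin [ P , R ]ʳ

    isEdge-intro : IsVertex P → RowLyndon (lexmin [ P , R ]ʳ) → IsLeastLabel P R →
                   IsEdge (P , R , lexmin [ dropFirst P , R ]ʳ)
    isEdge-intro {P} {R} P-vertex lyn least =
      P-vertex , (_ , lexmin-isLexmin _) ,
      firstColumn P , dropFirst P , sym ([firstColumn,dropFirst]ˡ P) , lexmin-isLexmin _ ,
      (lexmin [ P , R ]ʳ , ≡lexmin⇒isLexmin (cong lexmin ([firstColumn,[dropFirst,R]ʳ]ˡ P R)) , lyn) ,
      λ (R′ , R′<R , Q , isQ′ , isQ) → least R′<R (begin
        lexmin [ P , R′ ]ʳ                                ≡⟨ cong lexmin ([firstColumn,[dropFirst,R]ʳ]ˡ P R′) ⟨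
        lexmin [ firstColumn P , [ dropFirst P , R′ ]ʳ ]ˡ ≡⟨ isLexmin⇒≡lexmin isQ′ ⟨
        Q                                                 ≡⟨ isLexmin⇒≡lexmin isQ ⟩
        lexmin [ firstColumn P , [ dropFirst P , R ]ʳ ]ˡ  ≡⟨ cong lexmin ([firstColumn,[dropFirst,R]ʳ]ˡ P R) ⟩
        lexmin [ P , R ]ʳ                                 ∎)
      where open ≡-Reasoning

    isEdge-elim : IsEdge (P , R , P₂) →
                  IsVertex P × P₂ ≡ lexmin [ dropFirst P , R ]ʳ × RowLyndon (lexmin [ P , R ]ʳ) × IsLeastLabel P R
    isEdge-elim {R = R} (P-vertex , _ , L , C , refl , isP₂ , (Q , isQ , lyn) , notLeast) =
      P-vertex ,
      trans (isLexmin⇒≡lexmin isP₂) (cong (λ X → lexmin [ X , R ]ʳ) (sym (dropFirst-[,]ˡ L C))) ,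
      subst RowLyndon (trans (isLexmin⇒≡lexmin isQ) (cong lexmin ([,]ˡ-[,]ʳ L C R))) lyn ,
      λ {R′} R′<R same → notLeast (R′ , R′<R , lexmin [ [ L , C ]ˡ , R ]ʳ ,
        ≡lexmin⇒isLexmin (trans (cong lexmin ([,]ˡ-[,]ʳ L C R′)) same) ,
        ≡lexmin⇒isLexmin (cong lexmin ([,]ˡ-[,]ʳ L C R)))

    allColumns : List (Column k m)
    allColumns = allVecs (List.allFin k) m

    allWindows : List Window
    allWindows = allVecs (allVecs (List.allFin k) (suc (suc c))) m

    -- The rotation taking dropLast W to its lexmin, applied to the last column, rebuilds W;
    -- so some label always fits, which makes leastLabel well defined.
    someLabel : Window → Column k m
    someLabel W = rot (proj₁ (proj₁ (lexmin-isLexmin (dropLast W)))) (lastColumn W)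

    fits? : (W : Window) (R : Column k m) → Dec (lexmin [ lexmin (dropLast W) , R ]ʳ ≡ W)
    fits? W R = lexmin [ lexmin (dropLast W) , R ]ʳ ≟ₚ W

    leastLabel : Window → Column k m
    leastLabel W = Col.min (someLabel W) (filter (fits? W) allColumns)

    edgeOf : Window → Edge
    edgeOf W = lexmin (dropLast W) , leastLabel W , lexmin [ dropFirst (lexmin (dropLast W)) , leastLabel W ]ʳ

    windowOf : Edge → Window
    windowOf (P , R , _) = lexmin [ P , R ]ʳ

    someLabel-fits : lexmin W ≡ W → lexmin [ lexmin (dropLast W) , someLabel W ]ʳ ≡ W
    someLabel-fits {W} W-fixed = let (j , _ , rotⱼ≡) = proj₁ (lexmin-isLexmin (dropLast W)) in begin
      lexmin [ lexmin (dropLast W) , rot j (lastColumn W) ]ʳ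
        ≡⟨ cong (λ P → lexmin [ P , rot j (lastColumn W) ]ʳ) rotⱼ≡ ⟨
      lexmin [ rot j (dropLast W) , rot j (lastColumn W) ]ʳ
        ≡⟨ cong lexmin (rot-zipWith j _∷ʳ_ (dropLast W) (lastColumn W)) ⟨
      lexmin (rot j [ dropLast W , lastColumn W ]ʳ)
        ≡⟨ lexmin-rot j _ ⟩
      lexmin [ dropLast W , lastColumn W ]ʳ
        ≡⟨ cong lexmin ([dropLast,lastColumn]ʳ W) ⟩
      lexmin W
        ≡⟨ W-fixed ⟩
      W ∎
      where open ≡-Reasoning

    label-fits : lexmin W ≡ W → R ∈ someLabel W ∷ filter (fits? W) allColumns →
                 lexmin [ lexmin (dropLast W) , R ]ʳ ≡ W
    label-fits W-fixed (here refl)    = someLabel-fits W-fixed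
    label-fits {W} W-fixed (there R∈) = proj₂ (∈-filter⁻ (fits? W) {xs = allColumns} R∈)

    leastLabel-fits : lexmin W ≡ W → lexmin [ lexmin (dropLast W) , leastLabel W ]ʳ ≡ W
    leastLabel-fits {W} W-fixed = label-fits W-fixed (Col.min-∈ (someLabel W) (filter (fits? W) allColumns))

    leastLabel-least : lexmin [ lexmin (dropLast W) , R ]ʳ ≡ W → Col._≼_ (leastLabel W) R
    leastLabel-least {W} {R} fits = Col.min-≼ (there (∈-filter⁺ (fits? W) (∈-allVecs ∈-allFin R) fits))

    edgeOf-isEdge : RowLyndon W → IsEdge (edgeOf W)
    edgeOf-isEdge {W} lyn =
      isEdge-intro (dropLast W , lexmin-isLexmin (dropLast W)) (subst RowLyndon (sym fits) lyn)
                   (λ R′<R same → Col.≼⇒≯ (leastLabel-least (trans same fits)) R′<R)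
      where fits = leastLabel-fits (rowLyndon⇒lexmin-fixed lyn)

    windowOf-rowLyndon : IsEdge e → RowLyndon (windowOf e)
    windowOf-rowLyndon isE = proj₁ (proj₂ (proj₂ (isEdge-elim isE)))

    windowOf-fixed : ∀ e → lexmin (windowOf e) ≡ windowOf e
    windowOf-fixed (P , R , _) = lexmin-idem [ P , R ]ʳ

    windowOf-edgeOf : lexmin W ≡ W → windowOf (edgeOf W) ≡ W
    windowOf-edgeOf = leastLabel-fits

    edgeOf-windowOf : IsEdge e → edgeOf (windowOf e) ≡ e
    edgeOf-windowOf {P , R , P₂} isE = begin
      edgeOf window
        ≡⟨ cong₂ (λ P′ R′ → P′ , R′ , lexmin [ dropFirst P′ , R′ ]ʳ) source label ⟩
      P , R , lexmin [ dropFirst P , R ]ʳ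
        ≡⟨ cong (λ X → P , R , X) P₂≡ ⟨
      P , R , P₂ ∎
      where
      open ≡-Reasoning
      window = lexmin [ P , R ]ʳ
      P-vertex = proj₁ (isEdge-elim isE)
      P₂≡ = proj₁ (proj₂ (isEdge-elim isE))
      notLeast = proj₂ (proj₂ (proj₂ (isEdge-elim isE)))
      source : lexmin (dropLast window) ≡ P
      source = begin
        lexmin (dropLast (lexmin [ P , R ]ʳ)) ≡⟨ lexmin-equivariant (map-equivariant init) [ P , R ]ʳ ⟩
        lexmin (dropLast [ P , R ]ʳ)          ≡⟨ cong lexmin (dropLast-[,]ʳ P R) ⟩
        lexmin P                              ≡⟨ isVertex⇒lexmin-fixed P-vertex ⟩
        P                                     ∎
      label : leastLabel window ≡ R
      label = Sum.[ (λ least≡R → least≡R) ,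
                    (λ least<R → ⊥-elim (notLeast least<R (trans
                      (cong (λ P′ → lexmin [ P′ , leastLabel window ]ʳ) (sym source))
                      (leastLabel-fits (lexmin-idem _))))) ]′
                  (leastLabel-least (cong (λ P′ → lexmin [ P′ , R ]ʳ) source))

    tgt-edgeOf : lexmin W ≡ W → tgt (edgeOf W) ≡ lexmin (dropFirst W)
    tgt-edgeOf {W} W-fixed = begin
      lexmin [ dropFirst P₁ , leastLabel W ]ʳ           ≡⟨ cong lexmin (dropFirst-[,]ʳ P₁ (leastLabel W)) ⟨
      lexmin (dropFirst [ P₁ , leastLabel W ]ʳ)          ≡⟨ lexmin-equivariant (map-equivariant tail) _ ⟨
      lexmin (dropFirst (lexmin [ P₁ , leastLabel W ]ʳ)) ≡⟨ cong (lexmin ∘ dropFirst) (leastLabel-fits W-fixed) ⟩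
      lexmin (dropFirst W)                              ∎
      where
      open ≡-Reasoning
      P₁ = lexmin (dropLast W)

    _≟ₑ_ : DecidableEquality Edge
    _≟ₑ_ = ×ₚ.≡-dec _≟ₚ_ (×ₚ.≡-dec (Vecₚ.≡-dec Finₚ._≟_) _≟ₚ_)

    edges : List Edge
    edges = deduplicate _≟ₑ_ (map edgeOf (filter rowLyndon? allWindows))

    edges-unique : Unique edges
    edges-unique = deduplicate-! _≟ₑ_ _

    ∈-edges⁺ : IsEdge e → e ∈ edges
    ∈-edges⁺ {e} isE = ∈-deduplicate⁺ _≟ₑ_ (subst (_∈ _) (edgeOf-windowOf isE) (∈-map⁺ edgeOf
      (∈-filter⁺ rowLyndon? (∈-allVecs (∈-allVecs ∈-allFin) (windowOf e)) (windowOf-rowLyndon isE))))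

    ∈-edges⁻ : e ∈ edges → IsEdge e
    ∈-edges⁻ e∈ with ∈-map⁻ edgeOf (∈-deduplicate⁻ _≟ₑ_ _ e∈)
    ... | W , W∈ , refl = edgeOf-isEdge (proj₂ (∈-filter⁻ rowLyndon? {xs = allWindows} W∈))

    edges-enumerate : Enumerates IsEdge edges
    edges-enumerate = edges-unique , λ e → mk⇔ ∈-edges⁺ ∈-edges⁻

    enumerates-filter : ∀ {Pr Q : Edge → Set} {es} → Enumerates Pr es → (Q? : Decidable Q) →
                        Enumerates (λ e → Pr e × Q e) (filter Q? es)
    enumerates-filter (es! , iff) Q? =
      filter⁺ Q? es! ,
      λ e → mk⇔ (λ (pr , q) → ∈-filter⁺ Q? (Equivalence.to (iff e) pr) q)
                (λ e∈ → let (e∈es , q) = ∈-filter⁻ Q? e∈ in Equivalence.from (iff e) e∈es , q)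

    transport : (Window → Window) → Edge → Edge
    transport h e = edgeOf (lexmin (h (windowOf e)))

    module _ {h h′ : Window → Window} (h′-equivariant : Equivariant h′) (h′∘h : ∀ X → h′ (h X) ≡ X) where

      transport-isEdge : IsEdge e → IsEdge (transport h e)
      transport-isEdge {e} isE = edgeOf-isEdge (primitive⇒rowLyndon-lexmin (primitive-reflect h′-equivariant
        (subst Primitive (sym (h′∘h (windowOf e))) (rowLyndon⇒primitive (windowOf-rowLyndon isE)))))

      transport-inverse : IsEdge e → transport h′ (transport h e) ≡ e
      transport-inverse {e} isE = begin
        edgeOf (lexmin (h′ (windowOf (edgeOf (lexmin (h window))))))
          ≡⟨ cong (edgeOf ∘ lexmin ∘ h′) (windowOf-edgeOf (lexmin-idem (h window))) ⟩
        edgeOf (lexmin (h′ (lexmin (h window))))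
          ≡⟨ cong edgeOf (lexmin-equivariant h′-equivariant (h window)) ⟩
        edgeOf (lexmin (h′ (h window)))
          ≡⟨ cong (edgeOf ∘ lexmin) (h′∘h window) ⟩
        edgeOf (lexmin window)
          ≡⟨ cong edgeOf (windowOf-fixed e) ⟩
        edgeOf window
          ≡⟨ edgeOf-windowOf isE ⟩
        e ∎
        where
        open ≡-Reasoning
        window = windowOf e

    tgt-transport-shiftColumnsRight : IsEdge e → tgt (transport shiftColumnsRight e) ≡ src e
    tgt-transport-shiftColumnsRight {e} isE = begin
      tgt (edgeOf (lexmin (shiftColumnsRight window)))       ≡⟨ tgt-edgeOf (lexmin-idem _) ⟩
      lexmin (dropFirst (lexmin (shiftColumnsRight window))) ≡⟨ lexmin-equivariant (map-equivariant tail) _ ⟩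
      lexmin (dropFirst (shiftColumnsRight window))          ≡⟨ cong lexmin (dropFirst-shiftColumnsRight window) ⟩
      src (edgeOf window)                                    ≡⟨ cong src (edgeOf-windowOf isE) ⟩
      src e                                                  ∎
      where
      open ≡-Reasoning
      window = windowOf e

    edges-balanced : Euler.Balanced edges
    edges-balanced = Euler.balanced-of-reversal (transport shiftColumnsRight)
      (map-↭-of-bijectionOn edges-unique
        (∈-edges⁺ ∘ transport-isEdge (map-equivariant rotate1) shiftColumnsLeft-Right ∘ ∈-edges⁻)
        (∈-edges⁺ ∘ transport-isEdge (map-equivariant (rot (suc c))) shiftColumnsRight-Left ∘ ∈-edges⁻)
        (transport-inverse (map-equivariant rotate1) shiftColumnsLeft-Right ∘ ∈-edges⁻)
        (transport-inverse (map-equivariant (rot (suc c))) shiftColumnsRight-Left ∘ ∈-edges⁻))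
      (tgt-transport-shiftColumnsRight ∘ ∈-edges⁻)

    vertex-balanced : ∀ v → Balanced v
    vertex-balanced v =
      filter (λ e → src e ≟ₚ v) edges , filter (λ e → tgt e ≟ₚ v) edges ,
      enumerates-filter edges-enumerate _ , enumerates-filter edges-enumerate _ ,
      Euler.balanced-degrees edges-balanced v

    walk⇒walkFrom : ∀ {u ws v} → Euler.Walk u ws v → WalkFrom u ws v
    walk⇒walkFrom {ws = []}     u≡v     = u≡v
    walk⇒walkFrom {ws = e ∷ ws} (s , w) = s , walk⇒walkFrom w

    module _ {R : Column k m} (R-primitive : Primitive R) where

      shiftIn-walk : ∀ j Y →
                     ∃ λ ws → ws ⊆ edges × Euler.Walk (lexmin Y) ws (lexmin (iterate (shiftInColumn R) Y j))
      shiftIn-walk zero    Y = [] , (λ ()) , refl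
      shiftIn-walk (suc j) Y =
        let (ws , ws⊆ , w) = shiftIn-walk j (shiftInColumn R Y) in
        edgeOf window ∷ ws ,
        (λ { (here refl) → ∈-edges⁺ (edgeOf-isEdge lyndon) ; (there e∈) → ws⊆ e∈ }) ,
        source , subst (λ u → Euler.Walk u ws (lexmin (iterate (shiftInColumn R) Y (suc j)))) (sym target) w
        where
        window = lexmin [ Y , R ]ʳ
        lyndon : RowLyndon window
        lyndon = primitive⇒rowLyndon-lexmin (primitive-reflect (map-equivariant last)
                   (subst Primitive (sym (lastColumn-[,]ʳ Y R)) R-primitive))
        source : lexmin (dropLast window) ≡ lexmin Y
        source = trans (lexmin-equivariant (map-equivariant init) [ Y , R ]ʳ) (cong lexmin (dropLast-[,]ʳ Y R))
        target : tgt (edgeOf window) ≡ lexmin (shiftInColumn R Y)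
        target = trans (tgt-edgeOf (lexmin-idem _)) (lexmin-equivariant (map-equivariant tail) [ Y , R ]ʳ)

      sink : VPat
      sink = lexmin (Vec.map (replicate (suc c)) R)

      reaches-sink : e ∈ edges → ∃ λ ws → ws ⊆ edges × Euler.Walk (src e) ws sink
      reaches-sink {P , _ , _} e∈ =
        let (ws , ws⊆ , w) = shiftIn-walk (suc c) P in
        ws , ws⊆ , subst₂ (λ u v → Euler.Walk u ws v) (isVertex⇒lexmin-fixed (proj₁ (∈-edges⁻ e∈)))
                                                      (cong lexmin (iterate-shiftInColumn-width R P)) w

      eulerian : Eulerian
      eulerian =
        let (ws , edges↭ws , b , w) = Euler.eulerian-circuit edges sink reaches-sink edges-balanced in
        (λ v _ → vertex-balanced v) ,
        ws , (↭ₛ.Unique-resp-↭ (≡.setoid Edge) (↭⇒↭ₛ edges↭ws) edges-unique ,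
              λ e → mk⇔ (∈-resp-↭ edges↭ws ∘ ∈-edges⁺)
                        (∈-edges⁻ ∘ ∈-resp-↭ (↭-sym edges↭ws))) ,
        b , walk⇒walkFrom w

-- Only k ≥ 2 (for the primitive column (1,0,…,0)) and m ≥ 1 are used; n enters only as c = n ∸ 2.
lemma4 : (k m n : ℕ) → 2 ≤ k → 2 ≤ m → 2 ≤ n → RingGraph.Eulerian k m (n ∸ 2)
lemma4 (suc (suc k′)) (suc m′) n _ _ _ =
  Necklaces.Ring.eulerian (suc (suc k′)) m′ (n ∸ 2)
    (∷-replicate-primitive {a = Fin.suc Fin.zero} {b = Fin.zero} λ ())
lemma4 (suc zero) _ _ (s≤s ()) _ _
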